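{- Let $n=p_1^{\alpha_1}p_2^{\alpha_2}\cdots p_r^{\alpha_r}$, where $r\geq 2$, $\alpha_1,\ldots,\alpha_r$ are positive integers and $p_1<p_2<\cdots<p_r$ are prime numbers. Let $m=p_{k_1}^{\beta_{k_1}}p_{k_2}^{\beta_{k_2}}\cdots p_{k_s}^{\beta_{k_s}}$, where $2\leq s\leq r$, $k_1<k_2<\cdots<k_s$ are indices in $\{1,\ldots,r\}$, and $1\leq\beta_{k_i}\leq\alpha_{k_i}$ for $1\leq i\leq s$. Suppose that at least one of the following holds: (i) $2\phi(p_1p_2\cdots p_r)\geq p_1p_2\cdots p_r$; (ii) $\phi(p_{j+1})\geq r\,\phi(p_j)$ for each $j\in\{1,2,\ldots,r-1\}$. Then $\deg(m)>\deg\!\left(\frac{m}{p_{k_i}}\right)$ in $\mathcal{P}(C_n)$ for every $i\in\{1,2,\ldots,s-1\}$.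
   Context: For a finite group $G$, the power graph $\mathcal{P}(G)$ is the simple undirected graph with vertex set $G$ in which two distinct vertices are adjacent if one of them is an integral power of the other. $C_n$ denotes the cyclic group of order $n$, identified with $\mathbb{Z}_n=\{0,1,\ldots,n-1\}$; a positive divisor $d$ of $n$ is regarded as the vertex $d \bmod n$. $\deg(a)$ denotes the degree of vertex $a$ in $\mathcal{P}(C_n)$ and $\phi$ Euler's totient function. -}

module Defs where

open import Data.Nat using (ℕ; zero; suc; _+_; _*_; _%_; _<_)
open import Data.Nat.Properties using (_≟_)
open import Data.Nat.GCD using (gcd)
open import Data.Fin using (Fin; zero; suc)
open import Data.List using (List; upTo; filter; length; map)
open import Data.List.Relation.Unary.Any using (Any; any?)
open import Data.Product using (_×_)
open import Data.Sum using (_⊎_)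
open import Relation.Nullary using (¬_; Dec; _×-dec_; _⊎-dec_; ¬?)
open import Relation.Binary.PropositionalEquality using (_≡_)

prodFin : (r : ℕ) → (Fin r → ℕ) → ℕ
prodFin zero    f = 1
prodFin (suc r) f = f zero * prodFin r (λ i → f (suc i))

φ : ℕ → ℕ
φ n = length (filter (λ k → gcd (suc k) n ≟ 1) (upTo n))

-- reduction modulo n into ℤ_n = {0,…,n-1}  (n = 0 never occurs below)
modN : ℕ → ℕ → ℕ
modN zero    a = a
modN (suc k) a = a % suc k

-- In C_n = ℤ_n (additive), the integral powers of a are the multiples k·a mod n;
-- since n·a = 0, it suffices to let k range over {0,…,n-1}.
-- IsPowerOf n b a : b is an integral power of a in C_n.
IsPowerOf : ℕ → ℕ → ℕ → Set
IsPowerOf n b a = Any (λ k → modN n (k * a) ≡ b) (upTo n)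

isPowerOf? : ∀ n b a → Dec (IsPowerOf n b a)
isPowerOf? n b a = any? (λ k → modN n (k * a) ≟ b) (upTo n)

Adj : ℕ → ℕ → ℕ → Set
Adj n a b = ¬ (a ≡ b) × (IsPowerOf n b a ⊎ IsPowerOf n a b)

adj? : ∀ n a b → Dec (Adj n a b)
adj? n a b = ¬? (a ≟ b) ×-dec (isPowerOf? n b a ⊎-dec isPowerOf? n a b)

deg : ℕ → ℕ → ℕ
deg n a = length (filter (λ b → adj? n (modN n a) b) (upTo n))

module Submission where

-- For a divisor d of n, the closed neighbourhood of d in P(C_n) is {b : d ∣ b or gcd(b, n) ∣ d}.
-- Write m = q p with p = p_{k_i}, and m = u t with t = p_{k_s} the largest prime of m, so p < t.
-- Then deg m − deg q is the number of b near m but not q minus the number near q but not m.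
-- The first set contains every b with gcd(b, n) = u, hence has at least φ(n/u) elements; the second
-- consists of multiples of q that are not multiples of m and have gcd(b, n) ≠ q, hence has at most
-- n/q − n/m − φ(n/q) elements. Every divisor d of n has φ(d)/d ≥ φ(P)/P for P = p_1⋯p_r, so it
-- suffices that (p − 1)P < (t + p)φ(P). Hypothesis (i) gives this directly since p < t, and (ii)
-- gives it through P ≤ (r + 1)φ(P), a telescoping product, and r(p − 1) ≤ t − 1.

open import Defs
open import Data.Nat using (ℕ; suc; _*_; _^_; _≤_; _<_; _∸_)
open import Data.Nat.Primality using (Prime)
open import Data.Fin using (Fin; toℕ) renaming (_<_ to _<ᶠ_)
open import Data.Product using (Σ; _×_)
open import Data.Sum using (_⊎_)
open import Relation.Binary.PropositionalEquality using (_≡_)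

open import Data.Empty using (⊥-elim)
open import Data.Fin using (zero; suc; inject₁; fromℕ; fromℕ<)
open import Data.Fin.Properties using (toℕ<n; toℕ-inject₁; toℕ-fromℕ; toℕ-fromℕ<; toℕ-injective)
open import Data.List using ([]; [_]; _++_; filter; length; upTo)
open import Data.List.Membership.Propositional using (lose)
open import Data.List.Membership.Propositional.Properties using (∈-upTo⁺)
open import Data.List.Properties using (length-++; upTo-∷ʳ; filter-++; filter-accept; filter-reject)
open import Data.List.Relation.Unary.Any using (satisfied)
open import Data.Nat
open import Data.Nat.Coprimality
  using (Coprime; coprime?; coprime-+; coprime-divisor; gcd≡1⇒coprime; coprime⇒gcd≡1; prime⇒coprime)
  renaming (sym to coprime-sym)
open import Data.Nat.Divisibility
open import Data.Nat.DivMod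
open import Data.Nat.GCD
open import Data.Nat.Primality using (prime⇒nonZero; prime⇒nonTrivial; prime⇒irreducible)
open import Data.Nat.Properties
open import Algebra.Properties.CommutativeSemigroup +-commutativeSemigroup
  using () renaming (interchange to +-interchange)
open import Data.Nat.Solver using (module +-*-Solver)
open +-*-Solver using (solve; _:*_; _:+_; _:=_; con)
open import Data.Product using (_,_; proj₁; proj₂; swap)
open import Data.Sum using (inj₁; inj₂)
open import Data.Unit using (tt)
open import Function using (id; _∘_)
open import Level using (0ℓ)
open import Relation.Binary.Core using (_Preserves_⟶_)
open import Relation.Binary.PropositionalEquality
  using (refl; sym; trans; cong; cong₂; subst; subst₂; module ≡-Reasoning)
open import Relation.Nullary using (Dec; yes; no; ¬_; ¬?; _×-dec_; _⊎-dec_)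
open import Relation.Unary using (Pred; Decidable)
open import Relation.Unary.Properties using (_∩?_; _∪?_; ∁?)

-- Counting below a bound

private
  variable
    P Q : Pred ℕ 0ℓ

indicator : {A : Set} → Dec A → ℕ
indicator (yes _) = 1
indicator (no _)  = 0

indicator-cong : {A B : Set} (a : Dec A) (b : Dec B) → (A → B) → (B → A) → indicator a ≡ indicator b
indicator-cong (yes _) (yes _) _   _   = refl
indicator-cong (yes a) (no ¬b) a→b _   = ⊥-elim (¬b (a→b a))
indicator-cong (no ¬a) (yes b) _   b→a = ⊥-elim (¬a (b→a b))
indicator-cong (no _)  (no _)  _   _   = refl

count : Decidable P → ℕ → ℕ
count P? zero    = 0
count P? (suc n) = count P? n + indicator (P? n)

count-mono : (P? : Decidable P) (Q? : Decidable Q) →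
             ∀ n → (∀ {b} → b < n → P b → Q b) → count P? n ≤ count Q? n
count-mono P? Q? zero    P⊆Q = z≤n
count-mono P? Q? (suc n) P⊆Q =
  +-mono-≤ (count-mono P? Q? n (λ b<n → P⊆Q (m<n⇒m<1+n b<n))) (indicator-mono (P? n) (Q? n) (P⊆Q ≤-refl))
  where
  indicator-mono : {A B : Set} (a : Dec A) (b : Dec B) → (A → B) → indicator a ≤ indicator b
  indicator-mono (yes _) (yes _) _   = ≤-refl
  indicator-mono (yes a) (no ¬b) a→b = ⊥-elim (¬b (a→b a))
  indicator-mono (no _)  _       _   = z≤n

module _ (P? : Decidable P) (Q? : Decidable Q) where

  count-∪-∩ : ∀ n → count (P? ∪? Q?) n + count (P? ∩? Q?) n ≡ count P? n + count Q? n
  count-∪-∩ zero    = refl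
  count-∪-∩ (suc n) = begin
    (∪n + indicator ((P? ∪? Q?) n)) + (∩n + indicator ((P? ∩? Q?) n))
      ≡⟨ +-interchange ∪n _ ∩n _ ⟩
    (∪n + ∩n) + (indicator ((P? ∪? Q?) n) + indicator ((P? ∩? Q?) n))
      ≡⟨ cong₂ _+_ (count-∪-∩ n) (indicator-∪-∩ (P? n) (Q? n)) ⟩
    (count P? n + count Q? n) + (indicator (P? n) + indicator (Q? n))
      ≡⟨ +-interchange (count P? n) (count Q? n) _ _ ⟩
    (count P? n + indicator (P? n)) + (count Q? n + indicator (Q? n)) ∎
    where
    open ≡-Reasoning
    ∪n = count (P? ∪? Q?) n
    ∩n = count (P? ∩? Q?) n
    indicator-∪-∩ : {A B : Set} (a : Dec A) (b : Dec B) →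
                    indicator (a ⊎-dec b) + indicator (a ×-dec b) ≡ indicator a + indicator b
    indicator-∪-∩ (yes _) (yes _) = refl
    indicator-∪-∩ (yes _) (no _)  = refl
    indicator-∪-∩ (no _)  (yes _) = refl
    indicator-∪-∩ (no _)  (no _)  = refl

  count-∩-∖ : ∀ n → count P? n ≡ count (P? ∩? Q?) n + count (P? ∩? ∁? Q?) n
  count-∩-∖ zero    = refl
  count-∩-∖ (suc n) = begin
    count P? n + indicator (P? n)
      ≡⟨ cong₂ _+_ (count-∩-∖ n) (indicator-∩-∖ (P? n) (Q? n)) ⟩
    (∩n + ∖n) + (indicator ((P? ∩? Q?) n) + indicator ((P? ∩? ∁? Q?) n))
      ≡⟨ +-interchange ∩n ∖n _ _ ⟩
    (∩n + indicator ((P? ∩? Q?) n)) + (∖n + indicator ((P? ∩? ∁? Q?) n)) ∎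
    where
    open ≡-Reasoning
    ∩n = count (P? ∩? Q?) n
    ∖n = count (P? ∩? ∁? Q?) n
    indicator-∩-∖ : {A B : Set} (a : Dec A) (b : Dec B) →
                    indicator a ≡ indicator (a ×-dec b) + indicator (a ×-dec ¬? b)
    indicator-∩-∖ (yes _) (yes _) = refl
    indicator-∩-∖ (yes _) (no _)  = refl
    indicator-∩-∖ (no _)  (yes _) = refl
    indicator-∩-∖ (no _)  (no _)  = refl

  count-cong : ∀ n → (∀ {b} → b < n → P b → Q b) → (∀ {b} → b < n → Q b → P b) →
               count P? n ≡ count Q? n
  count-cong n P⊆Q Q⊆P = ≤-antisym (count-mono P? Q? n P⊆Q) (count-mono Q? P? n Q⊆P)

module _ (P? : Decidable P) where

  count-all : ∀ n → (∀ {b} → b < n → P b) → count P? n ≡ n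
  count-all zero    _   = refl
  count-all (suc n) all with P? n
  ... | yes _  = trans (cong (_+ 1) (count-all n (λ b<n → all (m<n⇒m<1+n b<n)))) (+-comm n 1)
  ... | no ¬Pn = ⊥-elim (¬Pn (all ≤-refl))

  count-none : ∀ n → (∀ {b} → b < n → ¬ P b) → count P? n ≡ 0
  count-none zero    _    = refl
  count-none (suc n) none with P? n
  ... | yes Pn = ⊥-elim (none ≤-refl Pn)
  ... | no _   = trans (+-identityʳ _) (count-none n (λ b<n → none (m<n⇒m<1+n b<n)))

  count-pos : ∀ {n x} → x < n → P x → 1 ≤ count P? n
  count-pos {suc n} {x} x<1+n Px with P? n | m<1+n⇒m<n∨m≡n x<1+n
  ... | yes _  | _          = m≤n+m 1 _
  ... | no _   | inj₁ x<n   = subst (1 ≤_) (sym (+-identityʳ _)) (count-pos x<n Px)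
  ... | no ¬Pn | inj₂ refl  = ⊥-elim (¬Pn Px)

  count-+ : ∀ a c → count P? (a + c) ≡ count P? a + count (λ i → P? (a + i)) c
  count-+ a zero    = trans (cong (count P?) (+-identityʳ a)) (sym (+-identityʳ _))
  count-+ a (suc c) = begin
    count P? (a + suc c)
      ≡⟨ cong (count P?) (+-suc a c) ⟩
    count P? (a + c) + indicator (P? (a + c))
      ≡⟨ cong (_+ indicator (P? (a + c))) (count-+ a c) ⟩
    (count P? a + count (λ i → P? (a + i)) c) + indicator (P? (a + c))
      ≡⟨ +-assoc (count P? a) _ _ ⟩
    count P? a + (count (λ i → P? (a + i)) c + indicator (P? (a + c))) ∎
    where open ≡-Reasoning

  count-periodic : ∀ M → (∀ {b} → P (M + b) → P b) → (∀ {b} → P b → P (M + b)) →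
                   ∀ c → count P? (c * M) ≡ c * count P? M
  count-periodic M shift⇒ ⇒shift zero    = refl
  count-periodic M shift⇒ ⇒shift (suc c) = begin
    count P? (M + c * M)
      ≡⟨ count-+ M (c * M) ⟩
    count P? M + count (λ i → P? (M + i)) (c * M)
      ≡⟨ cong (count P? M +_) (count-cong (λ i → P? (M + i)) P? (c * M) (λ _ → shift⇒) (λ _ → ⇒shift)) ⟩
    count P? M + count P? (c * M)
      ≡⟨ cong (count P? M +_) (count-periodic M shift⇒ ⇒shift c) ⟩
    count P? M + c * count P? M ∎
    where open ≡-Reasoning

count-≡ : ∀ {x n} → x < n → count (x ≟_) n ≡ 1
count-≡ {x} {suc n} x<1+n with x ≟ n | m<1+n⇒m<n∨m≡n x<1+n
... | yes refl | _        = cong (_+ 1) (count-none (x ≟_) x (λ b<x x≡b → <-irrefl (sym x≡b) b<x))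
... | no _     | inj₁ x<n = trans (+-identityʳ _) (count-≡ x<n)
... | no x≢n   | inj₂ x≡n = ⊥-elim (x≢n x≡n)

count-multiples : (P? : Decidable P) (Q? : Decidable Q) (d : ℕ) .{{_ : NonZero d}} →
                  (∀ {b} → P b → d ∣ b) → (∀ {c} → P (c * d) → Q c) → (∀ {c} → Q c → P (c * d)) →
                  ∀ K → count P? (K * d) ≡ count Q? K
count-multiples P? Q? d P⇒∣ P⇒Q Q⇒P zero    = refl
count-multiples {P = P} P? Q? d@(suc d′) P⇒∣ P⇒Q Q⇒P (suc K) = begin
  count P? (d + K * d)                      ≡⟨ cong (count P?) (+-comm d (K * d)) ⟩
  count P? (K * d + d)                      ≡⟨ count-+ P? (K * d) d ⟩
  count P? (K * d) + count P?ₖ (1 + d′)     ≡⟨ cong₂ _+_ (count-multiples P? Q? d P⇒∣ P⇒Q Q⇒P K) block ⟩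
  count Q? K + indicator (Q? K)             ∎
  where
  open ≡-Reasoning
  P?ₖ : Decidable (λ i → P (K * d + i))
  P?ₖ i = P? (K * d + i)
  first : indicator (P?ₖ 0) ≡ indicator (Q? K)
  first = indicator-cong (P?ₖ 0) (Q? K) (P⇒Q ∘ subst P (+-identityʳ (K * d)))
                                        (subst P (sym (+-identityʳ (K * d))) ∘ Q⇒P)
  rest : ∀ {i} → i < d′ → ¬ P (K * d + (1 + i))
  rest i<d′ p = <-irrefl refl (≤-trans (s≤s i<d′) (∣⇒≤ (∣m+n∣m⇒∣n (P⇒∣ p) (n∣m*n K))))
  block : count P?ₖ (1 + d′) ≡ indicator (Q? K)
  block = begin
    count P?ₖ (1 + d′)
      ≡⟨ count-+ P?ₖ 1 d′ ⟩
    (0 + indicator (P?ₖ 0)) + count (λ i → P?ₖ (1 + i)) d′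
      ≡⟨ cong₂ _+_ first (count-none (λ i → P?ₖ (1 + i)) d′ rest) ⟩
    indicator (Q? K) + 0
      ≡⟨ +-identityʳ _ ⟩
    indicator (Q? K) ∎

count-∣ : ∀ d .{{_ : NonZero d}} K → count (d ∣?_) (K * d) ≡ K
count-∣ d K = begin
  count (d ∣?_) (K * d)
    ≡⟨ count-multiples (d ∣?_) (λ _ → yes tt) d id (λ _ → tt) (λ {c} _ → n∣m*n c) K ⟩
  count (λ _ → yes tt) K
    ≡⟨ count-all (λ _ → yes tt) K (λ _ → tt) ⟩
  K ∎
  where open ≡-Reasoning

length-filter-upTo : (P? : Decidable P) → ∀ n → length (filter P? (upTo n)) ≡ count P? n
length-filter-upTo P? zero    = refl
length-filter-upTo P? (suc n) = begin
  length (filter P? (upTo (suc n)))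
    ≡⟨ cong (length ∘ filter P?) (sym (upTo-∷ʳ n)) ⟩
  length (filter P? (upTo n ++ [ n ]))
    ≡⟨ cong length (filter-++ P? (upTo n) [ n ]) ⟩
  length (filter P? (upTo n) ++ filter P? [ n ])
    ≡⟨ length-++ (filter P? (upTo n)) ⟩
  length (filter P? (upTo n)) + length (filter P? [ n ])
    ≡⟨ cong₂ _+_ (length-filter-upTo P? n) (singleton (P? n)) ⟩
  count P? n + indicator (P? n) ∎
  where
  open ≡-Reasoning
  singleton : (Pn? : Dec _) → length (filter P? [ n ]) ≡ indicator Pn?
  singleton (yes Pn) = cong length (filter-accept P? {xs = []} Pn)
  singleton (no ¬Pn) = cong length (filter-reject P? {xs = []} ¬Pn)

count-rotate : (P? : Decidable P) → ∀ n → (P 0 → P n) → (P n → P 0) →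
               count (λ k → P? (suc k)) n ≡ count P? n
count-rotate P? n P0⇒Pn Pn⇒P0 = +-cancelʳ-≡ (indicator (P? n)) _ _ (begin
  count (λ k → P? (suc k)) n + indicator (P? n)
    ≡⟨ +-comm _ (indicator (P? n)) ⟩
  indicator (P? n) + count (λ k → P? (suc k)) n
    ≡⟨ cong (_+ count (λ k → P? (suc k)) n) (indicator-cong (P? n) (P? 0) Pn⇒P0 P0⇒Pn) ⟩
  indicator (P? 0) + count (λ k → P? (suc k)) n
    ≡⟨ count-+ P? 1 n ⟨
  count P? (suc n) ∎)
  where open ≡-Reasoning

-- Coprimality and Euler's totient

prime⇒>1 : ∀ {p} → Prime p → 1 < p
prime⇒>1 {p} pp = nonTrivial⇒n>1 p {{prime⇒nonTrivial pp}}

coprime-∣ʳ : ∀ {b x y} → Coprime b x → y ∣ x → Coprime b y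
coprime-∣ʳ b⊥x y∣x (d∣b , d∣y) = b⊥x (d∣b , ∣-trans d∣y y∣x)

coprime-∣ˡ : ∀ {b x y} → Coprime x b → y ∣ x → Coprime y b
coprime-∣ˡ x⊥b y∣x (d∣y , d∣b) = x⊥b (∣-trans d∣y y∣x , d∣b)

coprime-*ʳ : ∀ {b x y} → Coprime b x → Coprime b y → Coprime b (x * y)
coprime-*ʳ b⊥x b⊥y (d∣b , d∣xy) = b⊥y (d∣b , coprime-divisor (coprime-∣ˡ b⊥x d∣b) d∣xy)

coprime-^ʳ : ∀ {b x} a → Coprime b x → Coprime b (x ^ a)
coprime-^ʳ zero    b⊥x (_ , d∣1) = ∣1⇒≡1 d∣1
coprime-^ʳ (suc a) b⊥x = coprime-*ʳ b⊥x (coprime-^ʳ a b⊥x)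

∤-prime⇒coprime : ∀ {b x} → Prime x → ¬ x ∣ b → Coprime b x
∤-prime⇒coprime px x∤b (d∣b , d∣x) with prime⇒irreducible px d∣x
... | inj₁ d≡1  = d≡1
... | inj₂ refl = ⊥-elim (x∤b d∣b)

<-prime⇒∤ : ∀ {a t} → 1 < a → a < t → Prime t → ¬ a ∣ t
<-prime⇒∤ 1<a a<t pt a∣t with prime⇒irreducible pt a∣t
... | inj₁ refl = <-irrefl refl 1<a
... | inj₂ refl = <-irrefl refl a<t

coprime-+⁻¹ : ∀ {b M} → Coprime (M + b) M → Coprime b M
coprime-+⁻¹ M+b⊥M (d∣b , d∣M) = M+b⊥M (∣m∣n⇒∣m+n d∣M d∣b , d∣M)

φ-as-count : ∀ M → φ M ≡ count (λ b → coprime? b M) M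
φ-as-count M = begin
  φ M
    ≡⟨ length-filter-upTo (λ k → gcd (suc k) M ≟ 1) M ⟩
  count (λ k → gcd (suc k) M ≟ 1) M
    ≡⟨ count-cong _ _ M (λ _ → gcd≡1⇒coprime) (λ _ → coprime⇒gcd≡1) ⟩
  count (λ k → coprime? (suc k) M) M
    ≡⟨ count-rotate (λ b → coprime? b M) M 0⊥M⇒M⊥M M⊥M⇒0⊥M ⟩
  count (λ b → coprime? b M) M ∎
  where
  open ≡-Reasoning
  0⊥M⇒M⊥M : Coprime 0 M → Coprime M M
  0⊥M⇒M⊥M 0⊥M (_ , d∣M) = 0⊥M (_ ∣0 , d∣M)
  M⊥M⇒0⊥M : Coprime M M → Coprime 0 M
  M⊥M⇒0⊥M M⊥M (_ , d∣M) = M⊥M (d∣M , d∣M)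

φ-periodic : ∀ M K → count (λ b → coprime? b M) (K * M) ≡ K * φ M
φ-periodic M K = begin
  count (λ b → coprime? b M) (K * M) ≡⟨ count-periodic (λ b → coprime? b M) M coprime-+⁻¹ coprime-+ K ⟩
  K * count (λ b → coprime? b M) M   ≡⟨ cong (K *_) (φ-as-count M) ⟨
  K * φ M                            ∎
  where open ≡-Reasoning

φ-pos : ∀ {M} → 1 ≤ M → 1 ≤ φ M
φ-pos {M} 0<M = subst (1 ≤_) (sym (length-filter-upTo (λ k → gcd (suc k) M ≟ 1) M))
                      (count-pos (λ k → gcd (suc k) M ≟ 1) 0<M (gcd-zeroˡ M))

φ-prime : ∀ {x} → Prime x → φ x ≡ x ∸ 1
φ-prime {x@(suc x′)} px = begin
  φ x
    ≡⟨ length-filter-upTo (λ k → gcd (suc k) x ≟ 1) x ⟩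
  count (λ k → gcd (suc k) x ≟ 1) x′ + indicator (gcd x x ≟ 1)
    ≡⟨ cong₂ _+_ (count-all _ x′ below-x⊥x) x-not-coprime ⟩
  x′ + 0
    ≡⟨ +-identityʳ x′ ⟩
  x′ ∎
  where
  open ≡-Reasoning
  below-x⊥x : ∀ {k} → k < x′ → gcd (suc k) x ≡ 1
  below-x⊥x k<x′ = coprime⇒gcd≡1 (coprime-sym (prime⇒coprime px (s≤s k<x′)))
  x-not-coprime : indicator (gcd x x ≟ 1) ≡ 0
  x-not-coprime with gcd x x ≟ 1
  ... | no _          = refl
  ... | yes gcd[x,x]≡1 =
    ⊥-elim (<-irrefl (sym (∣1⇒≡1 (subst (x ∣_) gcd[x,x]≡1 (gcd-greatest ∣-refl ∣-refl)))) (prime⇒>1 px))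

suc-φ-prime : ∀ {x} → Prime x → suc (φ x) ≡ x
suc-φ-prime {suc x′} px = cong suc (φ-prime px)

φ-*-prime : ∀ {x} K → Prime x → φ x * φ K ≤ φ (x * K)
φ-*-prime {x@(suc x′)} K px = +-cancelˡ-≤ (φ K) _ _ (begin
  φ K + φ x * φ K
    ≡⟨ cong (λ y → φ K + y * φ K) (φ-prime px) ⟩
  φ K + x′ * φ K
    ≡⟨ φ-periodic K x ⟨
  count ⊥K? (x * K)
    ≡⟨ count-∩-∖ ⊥K? (x ∣?_) (x * K) ⟩
  count (⊥K? ∩? (x ∣?_)) (x * K) + count (⊥K? ∩? ∁? (x ∣?_)) (x * K)
    ≤⟨ +-mono-≤ multiples-of-x non-multiples-of-x ⟩
  φ K + φ (x * K) ∎)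
  where
  open ≤-Reasoning
  ⊥K? : Decidable (λ b → Coprime b K)
  ⊥K? b = coprime? b K
  multiples-of-x : count (⊥K? ∩? (x ∣?_)) (x * K) ≤ φ K
  multiples-of-x = begin
    count (⊥K? ∩? (x ∣?_)) (x * K)
      ≡⟨ cong (count (⊥K? ∩? (x ∣?_))) (*-comm x K) ⟩
    count (⊥K? ∩? (x ∣?_)) (K * x)
      ≡⟨ count-multiples (⊥K? ∩? (x ∣?_)) (λ c → ⊥K? (c * x)) x
                         proj₂ proj₁ (λ {c} c⊥K → c⊥K , n∣m*n c) K ⟩
    count (λ c → ⊥K? (c * x)) K
      ≤⟨ count-mono _ ⊥K? K (λ _ cx⊥K → coprime-∣ˡ cx⊥K (m∣m*n x)) ⟩
    count ⊥K? K
      ≡⟨ φ-as-count K ⟨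
    φ K ∎
  non-multiples-of-x : count (⊥K? ∩? ∁? (x ∣?_)) (x * K) ≤ φ (x * K)
  non-multiples-of-x = begin
    count (⊥K? ∩? ∁? (x ∣?_)) (x * K)     ≤⟨ count-mono _ (λ b → coprime? b (x * K)) (x * K)
                                               (λ _ (b⊥K , x∤b) → coprime-*ʳ (∤-prime⇒coprime px x∤b) b⊥K) ⟩
    count (λ b → coprime? b (x * K)) (x * K) ≡⟨ φ-as-count (x * K) ⟨
    φ (x * K)                              ∎

φ-prodFin : ∀ r (f : Fin r → ℕ) → (∀ j → Prime (f j)) → prodFin r (φ ∘ f) ≤ φ (prodFin r f)
φ-prodFin zero    f prime = φ-pos ≤-refl
φ-prodFin (suc r) f prime = begin
  φ (f zero) * prodFin r (φ ∘ f ∘ suc)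
    ≤⟨ *-monoʳ-≤ (φ (f zero)) (φ-prodFin r (f ∘ suc) (prime ∘ suc)) ⟩
  φ (f zero) * φ (prodFin r (f ∘ suc))
    ≤⟨ φ-*-prime _ (prime zero) ⟩
  φ (f zero * prodFin r (λ j → f (suc j))) ∎
  where open ≤-Reasoning

-- The coprimality hypothesis says that every prime factor of n divides P; then φ(P)/P ≤ φ(M)/M.
φ-density : ∀ {n M K P L} → n ≡ K * M → n ≡ L * P → (∀ {b} → Coprime b P → Coprime b n) →
            L * φ P ≤ K * φ M
φ-density {n} {M} {K} {P} {L} refl n≡LP P⇒n = begin
  L * φ P
    ≡⟨ φ-periodic P L ⟨
  count (⊥? P) (L * P)
    ≡⟨ cong (count (⊥? P)) n≡LP ⟨
  count (⊥? P) n
    ≡⟨ count-cong (⊥? P) (⊥? n) n (λ _ → P⇒n) (λ _ b⊥n → coprime-∣ʳ b⊥n (divides L n≡LP)) ⟩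
  count (⊥? n) n
    ≤⟨ count-mono (⊥? n) (⊥? M) n (λ _ b⊥n → coprime-∣ʳ b⊥n (n∣m*n K)) ⟩
  count (⊥? M) n
    ≡⟨ φ-periodic M K ⟩
  K * φ M ∎
  where
  open ≤-Reasoning
  ⊥? : ∀ N → Decidable (λ b → Coprime b N)
  ⊥? N b = coprime? b N

count-gcd≡ : ∀ {n} M d .{{_ : NonZero d}} → n ≡ M * d → count (λ b → gcd b n ≟ d) n ≡ φ M
count-gcd≡ M d refl = begin
  count (λ b → gcd b (M * d) ≟ d) (M * d)
    ≡⟨ count-multiples _ (λ c → coprime? c M) d gcd≡d⇒d∣ gcd≡d⇒coprime coprime⇒gcd≡d M ⟩
  count (λ c → coprime? c M) M
    ≡⟨ φ-as-count M ⟨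
  φ M ∎
  where
  open ≡-Reasoning
  gcd-*ʳ : ∀ c → gcd (c * d) (M * d) ≡ gcd c M * d
  gcd-*ʳ c = begin
    gcd (c * d) (M * d) ≡⟨ cong₂ gcd (*-comm c d) (*-comm M d) ⟩
    gcd (d * c) (d * M) ≡⟨ c*gcd[m,n]≡gcd[cm,cn] d c M ⟨
    d * gcd c M         ≡⟨ *-comm d _ ⟩
    gcd c M * d         ∎
  gcd≡d⇒d∣ : ∀ {b} → gcd b (M * d) ≡ d → d ∣ b
  gcd≡d⇒d∣ {b} e = subst (_∣ b) e (gcd[m,n]∣m b (M * d))
  gcd≡d⇒coprime : ∀ {c} → gcd (c * d) (M * d) ≡ d → Coprime c M
  gcd≡d⇒coprime {c} e =
    gcd≡1⇒coprime (*-cancelʳ-≡ (gcd c M) 1 d (trans (sym (gcd-*ʳ c)) (trans e (sym (*-identityˡ d)))))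
  coprime⇒gcd≡d : ∀ {c} → Coprime c M → gcd (c * d) (M * d) ≡ d
  coprime⇒gcd≡d {c} c⊥M = trans (gcd-*ʳ c) (trans (cong (_* d) (coprime⇒gcd≡1 c⊥M)) (*-identityˡ d))

-- The power graph of C_n

m*[n%o]%o≡m*n%o : ∀ m n o .{{_ : NonZero o}} → (m * (n % o)) % o ≡ (m * n) % o
m*[n%o]%o≡m*n%o m n o = begin
  (m * (n % o)) % o              ≡⟨ %-distribˡ-* m (n % o) o ⟩
  ((m % o) * (n % o % o)) % o    ≡⟨ cong (λ z → ((m % o) * z) % o) (m%n%n≡m%n n o) ⟩
  ((m % o) * (n % o)) % o        ≡⟨ %-distribˡ-* m n o ⟨
  (m * n) % o                    ∎
  where open ≡-Reasoning

[m%o]*n%o≡m*n%o : ∀ m n o .{{_ : NonZero o}} → ((m % o) * n) % o ≡ (m * n) % o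
[m%o]*n%o≡m*n%o m n o = begin
  ((m % o) * n) % o ≡⟨ cong (_% o) (*-comm (m % o) n) ⟩
  (n * (m % o)) % o ≡⟨ m*[n%o]%o≡m*n%o n m o ⟩
  (n * m) % o       ≡⟨ cong (_% o) (*-comm n m) ⟩
  (m * n) % o       ∎
  where open ≡-Reasoning

gcd-multiple-mod : ∀ b n .{{_ : NonZero n}} → Σ ℕ λ k → (k * b) % n ≡ gcd b n % n
gcd-multiple-mod b n@(suc n′) with Bézout.identity (gcd-GCD b n)
... | Bézout.+- x y g+yn≡xb = x , (begin
  (x * b) % n               ≡⟨ cong (_% n) g+yn≡xb ⟨
  (gcd b n + y * n) % n     ≡⟨ [m+kn]%n≡m%n (gcd b n) y n ⟩
  gcd b n % n               ∎)
  where open ≡-Reasoning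
-- Here gcd b n = y n − x b, and x n′ stands for −x modulo n = 1 + n′.
... | Bézout.-+ x y g+xb≡yn = x * n′ , (begin
  (x * n′ * b) % n
    ≡⟨ [m+kn]%n≡m%n (x * n′ * b) y n ⟨
  (x * n′ * b + y * n) % n
    ≡⟨ cong (λ z → (x * n′ * b + z) % n) g+xb≡yn ⟨
  (x * n′ * b + (gcd b n + x * b)) % n
    ≡⟨ cong (_% n) (solve 4 (λ x n′ b g → x :* n′ :* b :+ (g :+ x :* b) := g :+ (x :* b) :* (con 1 :+ n′))
                            refl x n′ b (gcd b n)) ⟩
  (gcd b n + (x * b) * n) % n
    ≡⟨ [m+kn]%n≡m%n (gcd b n) (x * b) n ⟩
  gcd b n % n ∎)
  where open ≡-Reasoning

IsPowerOf-divisor⇒∣ : ∀ {n} .{{_ : NonZero n}} {d b} → d ∣ n → IsPowerOf n b (d % n) → d ∣ b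
IsPowerOf-divisor⇒∣ {n@(suc _)} {d} d∣n kd≡b with satisfied kd≡b
... | k , eq = subst (d ∣_) eq (%-presˡ-∣ (∣n⇒∣m*n k (%-presˡ-∣ ∣-refl d∣n)) d∣n)

∣⇒IsPowerOf-divisor : ∀ {n} .{{_ : NonZero n}} {d b} .{{_ : NonZero d}} → b < n → d ∣ b → IsPowerOf n b (d % n)
∣⇒IsPowerOf-divisor {n@(suc _)} {d} b<n (divides c refl) = lose (∈-upTo⁺ c<n) (begin
  (c * (d % n)) % n ≡⟨ m*[n%o]%o≡m*n%o c d n ⟩
  (c * d) % n       ≡⟨ m<n⇒m%n≡m b<n ⟩
  c * d             ∎)
  where
  open ≡-Reasoning
  c<n : c < n
  c<n = ≤-<-trans (m≤m*n c d) b<n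

IsPowerOf⇒gcd∣divisor : ∀ {n} .{{_ : NonZero n}} {d b} → d ∣ n → IsPowerOf n (d % n) b → gcd b n ∣ d
IsPowerOf⇒gcd∣divisor {n@(suc _)} {d} {b} d∣n kb≡d with satisfied kb≡d
... | k , eq = ∣n∣m%n⇒∣m (gcd[m,n]∣n b n)
                  (subst (gcd b n ∣_) eq (%-presˡ-∣ (∣n⇒∣m*n k (gcd[m,n]∣m b n)) (gcd[m,n]∣n b n)))

gcd∣⇒IsPowerOf : ∀ {n} .{{_ : NonZero n}} {d b} → gcd b n ∣ d → IsPowerOf n (d % n) b
gcd∣⇒IsPowerOf {n@(suc _)} {d} {b} (divides e refl) with gcd-multiple-mod b n
... | k , kb≡g = lose (∈-upTo⁺ (m%n<n (e * k) n)) (begin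
  ((e * k) % n * b) % n   ≡⟨ [m%o]*n%o≡m*n%o (e * k) b n ⟩
  (e * k * b) % n         ≡⟨ cong (_% n) (*-assoc e k b) ⟩
  (e * (k * b)) % n       ≡⟨ m*[n%o]%o≡m*n%o e (k * b) n ⟨
  (e * ((k * b) % n)) % n ≡⟨ cong (λ z → (e * z) % n) kb≡g ⟩
  (e * (gcd b n % n)) % n ≡⟨ m*[n%o]%o≡m*n%o e (gcd b n) n ⟩
  (e * gcd b n) % n       ∎)
  where open ≡-Reasoning

-- For a divisor d of n this is the closed neighbourhood of d in P(C_n): b is a power of d iff d ∣ b,
-- and d is a power of b iff gcd b n ∣ d.
ClosedNbhd : ℕ → ℕ → Pred ℕ 0ℓ
ClosedNbhd n d b = d ∣ b ⊎ gcd b n ∣ d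

closedNbhd? : ∀ n d → Decidable (ClosedNbhd n d)
closedNbhd? n d b = d ∣? b ⊎-dec gcd b n ∣? d

deg+1≡count-closedNbhd : ∀ {n} .{{_ : NonZero n}} d .{{_ : NonZero d}} → d ∣ n →
                          deg n d + 1 ≡ count (closedNbhd? n d) n
deg+1≡count-closedNbhd {n@(suc _)} d d∣n = begin
  deg n d + 1                                       ≡⟨ cong (_+ 1) (length-filter-upTo (adj? n d̄) n) ⟩
  count (adj? n d̄) n + 1                            ≡⟨ +-comm _ 1 ⟩
  1 + count (adj? n d̄) n                            ≡⟨ cong₂ _+_ (sym d-itself) (sym d-others) ⟩
  count (N? ∩? (d̄ ≟_)) n + count (N? ∩? ∁? (d̄ ≟_)) n ≡⟨ count-∩-∖ N? (d̄ ≟_) n ⟨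
  count N? n                                        ∎
  where
  open ≡-Reasoning
  d̄ = d % n
  N? = closedNbhd? n d
  d-itself : count (N? ∩? (d̄ ≟_)) n ≡ 1
  d-itself = trans (count-cong _ (d̄ ≟_) n (λ _ → proj₂) (λ { _ refl → inj₁ (%-presˡ-∣ ∣-refl d∣n) , refl }))
                   (count-≡ (m%n<n d n))
  toNbhd : ∀ {b} → IsPowerOf n b d̄ ⊎ IsPowerOf n d̄ b → ClosedNbhd n d b
  toNbhd (inj₁ b∈⟨d⟩) = inj₁ (IsPowerOf-divisor⇒∣ d∣n b∈⟨d⟩)
  toNbhd (inj₂ d∈⟨b⟩) = inj₂ (IsPowerOf⇒gcd∣divisor d∣n d∈⟨b⟩)
  fromNbhd : ∀ {b} → b < n → ClosedNbhd n d b → IsPowerOf n b d̄ ⊎ IsPowerOf n d̄ b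
  fromNbhd b<n (inj₁ d∣b)   = inj₁ (∣⇒IsPowerOf-divisor b<n d∣b)
  fromNbhd b<n (inj₂ gcd∣d) = inj₂ (gcd∣⇒IsPowerOf gcd∣d)
  d-others : count (N? ∩? ∁? (d̄ ≟_)) n ≡ count (adj? n d̄) n
  d-others = count-cong _ (adj? n d̄) n (λ b<n (b∈N , d̄≢b) → d̄≢b , fromNbhd b<n b∈N)
                                       (λ _ (d̄≢b , b∼d̄) → toNbhd b∼d̄ , d̄≢b)

deg-<-closedNbhd : ∀ {n} .{{_ : NonZero n}} c d .{{_ : NonZero c}} .{{_ : NonZero d}} → c ∣ n → d ∣ n →
                   count (closedNbhd? n c ∩? ∁? (closedNbhd? n d)) n < count (closedNbhd? n d ∩? ∁? (closedNbhd? n c)) n →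
                   deg n c < deg n d
deg-<-closedNbhd {n} c d c∣n d∣n excess< = +-cancelʳ-< 1 (deg n c) (deg n d) (begin-strict
  deg n c + 1
    ≡⟨ deg+1≡count-closedNbhd c c∣n ⟩
  count Nc? n
    ≡⟨ count-∩-∖ Nc? Nd? n ⟩
  count (Nc? ∩? Nd?) n + count (Nc? ∩? ∁? Nd?) n
    <⟨ +-monoʳ-< (count (Nc? ∩? Nd?) n) excess< ⟩
  count (Nc? ∩? Nd?) n + count (Nd? ∩? ∁? Nc?) n
    ≡⟨ cong (_+ count (Nd? ∩? ∁? Nc?) n) (count-cong _ _ n (λ _ → swap) (λ _ → swap)) ⟩
  count (Nd? ∩? Nc?) n + count (Nd? ∩? ∁? Nc?) n
    ≡⟨ count-∩-∖ Nd? Nc? n ⟨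
  count Nd? n
    ≡⟨ deg+1≡count-closedNbhd d d∣n ⟨
  deg n d + 1 ∎)
  where
  open ≤-Reasoning
  Nc? = closedNbhd? n c
  Nd? = closedNbhd? n d

module _ {n} .{{_ : NonZero n}} {q m} .{{_ : NonZero q}} .{{_ : NonZero m}} where

  private
    Nq? = closedNbhd? n q
    Nm? = closedNbhd? n m

  count-closedNbhd-∖-upper : ∀ {M N} → n ≡ M * q → n ≡ N * m → q ∣ m → ¬ m ∣ q →
                             count (Nq? ∩? ∁? Nm?) n + φ M + N ≤ M
  count-closedNbhd-∖-upper {M} {N} n≡Mq n≡Nm q∣m m∤q = begin
    count A? n + φ M + N
      ≡⟨ cong (λ z → count A? n + z + N) (count-gcd≡ M q n≡Mq) ⟨
    count A? n + count B? n + N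
      ≡⟨ cong (_+ N) (count-∪-∩ A? B? n) ⟨
    count (A? ∪? B?) n + count (A? ∩? B?) n + N
      ≡⟨ cong (λ z → count (A? ∪? B?) n + z + N) (count-none (A? ∩? B?) n disjoint) ⟩
    count (A? ∪? B?) n + 0 + N
      ≡⟨ cong (_+ N) (+-identityʳ _) ⟩
    count (A? ∪? B?) n + N
      ≤⟨ +-monoˡ-≤ N (count-mono (A? ∪? B?) W? n A∪B⊆W) ⟩
    count W? n + N
      ≡⟨ +-comm _ N ⟩
    N + count W? n
      ≡⟨ cong (_+ count W? n) q∣∩m∣ ⟨
    count (q∣? ∩? m∣?) n + count W? n
      ≡⟨ count-∩-∖ q∣? m∣? n ⟨
    count q∣? n
      ≡⟨ trans (cong (count q∣?) n≡Mq) (count-∣ q M) ⟩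
    M ∎
    where
    open ≤-Reasoning
    q∣? = q ∣?_
    m∣? = m ∣?_
    A? = Nq? ∩? ∁? Nm?
    B? = λ b → gcd b n ≟ q
    W? = q∣? ∩? ∁? m∣?
    disjoint : ∀ {b} → b < n → ¬ ((ClosedNbhd n q b × ¬ ClosedNbhd n m b) × gcd b n ≡ q)
    disjoint _ ((_ , b∉Nm) , gcd≡q) = b∉Nm (inj₂ (subst (_∣ m) (sym gcd≡q) q∣m))
    A∪B⊆W : ∀ {b} → b < n → (ClosedNbhd n q b × ¬ ClosedNbhd n m b) ⊎ gcd b n ≡ q → q ∣ b × ¬ m ∣ b
    A∪B⊆W _ (inj₁ (inj₁ q∣b , b∉Nm))   = q∣b , b∉Nm ∘ inj₁
    A∪B⊆W _ (inj₁ (inj₂ gcd∣q , b∉Nm)) = ⊥-elim (b∉Nm (inj₂ (∣-trans gcd∣q q∣m)))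
    A∪B⊆W {b} _ (inj₂ gcd≡q) =
      subst (_∣ b) gcd≡q (gcd[m,n]∣m b n) ,
      λ m∣b → m∤q (subst (m ∣_) gcd≡q (gcd-greatest m∣b (divides N n≡Nm)))
    q∣∩m∣ : count (q∣? ∩? m∣?) n ≡ N
    q∣∩m∣ = trans (count-cong _ m∣? n (λ _ → proj₂) (λ _ m∣b → ∣-trans q∣m m∣b , m∣b))
                  (trans (cong (count m∣?) n≡Nm) (count-∣ m N))

  count-closedNbhd-∖-lower : ∀ {u K} .{{_ : NonZero u}} → n ≡ K * u → u ∣ m → q ∣ n → ¬ q ∣ u → ¬ u ∣ q →
                             φ K ≤ count (Nm? ∩? ∁? Nq?) n
  count-closedNbhd-∖-lower {u} {K} n≡Ku u∣m q∣n q∤u u∤q = begin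
    φ K                          ≡⟨ count-gcd≡ K u n≡Ku ⟨
    count (λ b → gcd b n ≟ u) n  ≤⟨ count-mono _ (Nm? ∩? ∁? Nq?) n gcd≡u⇒∈Nm∖Nq ⟩
    count (Nm? ∩? ∁? Nq?) n      ∎
    where
    open ≤-Reasoning
    gcd≡u⇒∈Nm∖Nq : ∀ {b} → b < n → gcd b n ≡ u → ClosedNbhd n m b × ¬ ClosedNbhd n q b
    gcd≡u⇒∈Nm∖Nq {b} _ gcd≡u = inj₂ (subst (_∣ m) (sym gcd≡u) u∣m) , λ
      { (inj₁ q∣b)   → q∤u (subst (q ∣_) gcd≡u (gcd-greatest q∣b q∣n))
      ; (inj₂ gcd∣q) → u∤q (subst (_∣ q) gcd≡u gcd∣q) }

nonZero-factorˡ : ∀ {n} a b .{{_ : NonZero n}} → n ≡ a * b → NonZero a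
nonZero-factorˡ {suc _} (suc _) _ _ = _

nonZero-factorʳ : ∀ {n} a b .{{_ : NonZero n}} → n ≡ a * b → NonZero b
nonZero-factorʳ a b n≡ab = nonZero-factorˡ b a (trans n≡ab (*-comm a b))

-- With φ(d)/d ≥ φ(P)/P for d = n/q and d = n/u, the hypothesis on P gives φ(n/u) + φ(n/q) > n/q − n/m.
totient-excess : ∀ {n m} N q p u t L P .{{_ : NonZero n}} → n ≡ N * m → q * p ≡ m → u * t ≡ m → n ≡ L * P →
                 (∀ {b} → Coprime b P → Coprime b n) → 1 ≤ p → (p ∸ 1) * P < (t + p) * φ P →
                 N * p < φ (N * t) + φ (N * p) + N
totient-excess {n} {m} N q p@(suc p′) u t L P n≡Nm qp≡m ut≡m n≡LP P⇒n _ bound =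
  *-cancelˡ-< m (N * p) (φ (N * t) + φ (N * p) + N) (begin-strict
    m * (N * p)
      ≡⟨ solve 3 (λ m N p′ → m :* (N :* (con 1 :+ p′)) := p′ :* (N :* m) :+ m :* N) refl m N p′ ⟩
    p′ * (N * m) + m * N
      ≡⟨ cong (λ z → p′ * z + m * N) (trans (sym n≡Nm) n≡LP) ⟩
    p′ * (L * P) + m * N
      ≡⟨ cong (_+ m * N) (solve 3 (λ p′ L P → p′ :* (L :* P) := L :* (p′ :* P)) refl p′ L P) ⟩
    L * (p′ * P) + m * N
      <⟨ +-monoˡ-< (m * N) (*-monoʳ-< L {{nonZero-factorˡ L P n≡LP}} bound) ⟩
    L * ((t + p) * φ P) + m * N
      ≡⟨ cong (_+ m * N) (solve 4 (λ L t p Φ → L :* ((t :+ p) :* Φ) := t :* (L :* Φ) :+ p :* (L :* Φ))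
                                  refl L t p (φ P)) ⟩
    t * (L * φ P) + p * (L * φ P) + m * N
      ≤⟨ +-monoˡ-≤ (m * N) (+-mono-≤ (*-monoʳ-≤ t (density u t ut≡m)) (*-monoʳ-≤ p (density q p qp≡m))) ⟩
    t * (u * φ (N * t)) + p * (q * φ (N * p)) + m * N
      ≡⟨ cong₂ (λ x y → x + y + m * N) (regroup t u ut≡m) (regroup p q qp≡m) ⟩
    m * φ (N * t) + m * φ (N * p) + m * N
      ≡⟨ solve 4 (λ m a b c → m :* a :+ m :* b :+ m :* c := m :* (a :+ b :+ c))
                 refl m (φ (N * t)) (φ (N * p)) N ⟩
    m * (φ (N * t) + φ (N * p) + N) ∎)
  where
  open ≤-Reasoning
  density : ∀ x y → x * y ≡ m → L * φ P ≤ x * φ (N * y)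
  density x y xy≡m = φ-density {M = N * y} {K = x} {L = L} n≡x[Ny] n≡LP P⇒n
    where
    n≡x[Ny] : n ≡ x * (N * y)
    n≡x[Ny] = trans n≡Nm (trans (cong (N *_) (sym xy≡m)) (solve 3 (λ N x y → N :* (x :* y) := x :* (N :* y)) refl N x y))
  regroup : ∀ x y → y * x ≡ m → ∀ {z} → x * (y * z) ≡ m * z
  regroup x y yx≡m {z} = trans (solve 3 (λ x y z → x :* (y :* z) := (y :* x) :* z) refl x y z) (cong (_* z) yx≡m)

∣-cofactor : ∀ {a b c d} .{{_ : NonZero a}} → a * b ≡ c * d → a ∣ c → d ∣ b
∣-cofactor {a} {b} {c} {d} ab≡cd (divides w refl) = divides w (*-cancelˡ-≡ b (w * d) a (begin
  a * b       ≡⟨ ab≡cd ⟩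
  w * a * d   ≡⟨ solve 3 (λ w a d → w :* a :* d := a :* (w :* d)) refl w a d ⟩
  a * (w * d) ∎))
  where open ≡-Reasoning

deg-<-of-totient-bound : ∀ {n m q} p u t L P .{{_ : NonZero n}} → m ∣ n → q * p ≡ m → u * t ≡ m →
                         1 < p → p < t → ¬ p ∣ t → n ≡ L * P → (∀ {b} → Coprime b P → Coprime b n) →
                         (p ∸ 1) * P < (t + p) * φ P → deg n q < deg n m
deg-<-of-totient-bound {n} {m} {q} p u t L P (divides N n≡Nm) qp≡m ut≡m 1<p p<t p∤t n≡LP P⇒n bound =
  deg-<-closedNbhd q m q∣n m∣n
    (<-≤-trans near-q-only<φ (count-closedNbhd-∖-lower {u = u} {K = N * t} (n≡[n/x]*x u t ut≡m) u∣m q∣n q∤u u∤q))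
  where
  open ≤-Reasoning
  instance
    m-nonZero : NonZero m
    m-nonZero = nonZero-factorʳ N m n≡Nm
    q-nonZero : NonZero q
    q-nonZero = nonZero-factorˡ q p {{m-nonZero}} (sym qp≡m)
    u-nonZero : NonZero u
    u-nonZero = nonZero-factorˡ u t {{m-nonZero}} (sym ut≡m)
  m∣n : m ∣ n
  m∣n = divides N n≡Nm
  q∣m : q ∣ m
  q∣m = divides p (trans (sym qp≡m) (*-comm q p))
  u∣m : u ∣ m
  u∣m = divides t (trans (sym ut≡m) (*-comm u t))
  q∣n : q ∣ n
  q∣n = ∣-trans q∣m m∣n
  n≡[n/x]*x : ∀ x y → x * y ≡ m → n ≡ (N * y) * x
  n≡[n/x]*x x y xy≡m =
    trans n≡Nm (trans (cong (N *_) (sym xy≡m)) (solve 3 (λ N x y → N :* (x :* y) := (N :* y) :* x) refl N x y))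
  q∤u : ¬ q ∣ u
  q∤u q∣u = <⇒≱ p<t (∣⇒≤ {{nonZero-factorʳ q p (sym qp≡m)}} (∣-cofactor (trans qp≡m (sym ut≡m)) q∣u))
  u∤q : ¬ u ∣ q
  u∤q u∣q = p∤t (∣-cofactor (trans ut≡m (sym qp≡m)) u∣q)
  m∤q : ¬ m ∣ q
  m∤q m∣q = <⇒≱ (subst (q <_) qp≡m (m<m*n q p 1<p)) (∣⇒≤ m∣q)
  near-q-only<φ : count (closedNbhd? n q ∩? ∁? (closedNbhd? n m)) n < φ (N * t)
  near-q-only<φ = +-cancelʳ-< (φ (N * p)) _ _ (+-cancelʳ-< N _ _ (begin-strict
    count (closedNbhd? n q ∩? ∁? (closedNbhd? n m)) n + φ (N * p) + N
      ≤⟨ count-closedNbhd-∖-upper {M = N * p} (n≡[n/x]*x q p qp≡m) n≡Nm q∣m m∤q ⟩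
    N * p
      <⟨ totient-excess N q p u t L P n≡Nm qp≡m ut≡m n≡LP P⇒n (<⇒≤ 1<p) bound ⟩
    φ (N * t) + φ (N * p) + N ∎))

-- Products over Fin r

prodFin-cong : ∀ r {f g : Fin r → ℕ} → (∀ j → f j ≡ g j) → prodFin r f ≡ prodFin r g
prodFin-cong zero    f≡g = refl
prodFin-cong (suc r) f≡g = cong₂ _*_ (f≡g zero) (prodFin-cong r (f≡g ∘ suc))

prodFin-∣ : ∀ r {f g : Fin r → ℕ} → (∀ j → f j ∣ g j) → prodFin r f ∣ prodFin r g
prodFin-∣ zero    f∣g = ∣-refl
prodFin-∣ (suc r) f∣g = *-pres-∣ (f∣g zero) (prodFin-∣ r (f∣g ∘ suc))

prodFin-pos : ∀ r {f : Fin r → ℕ} → (∀ j → 1 ≤ f j) → 1 ≤ prodFin r f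
prodFin-pos zero    pos = ≤-refl
prodFin-pos (suc r) pos = *-mono-≤ (pos zero) (prodFin-pos r (pos ∘ suc))

factor-∣-prodFin : ∀ {r} (f : Fin r → ℕ) j → f j ∣ prodFin r f
factor-∣-prodFin f zero    = m∣m*n _
factor-∣-prodFin f (suc j) = ∣n⇒∣m*n (f zero) (factor-∣-prodFin (f ∘ suc) j)

coprime-prodFin-^ : ∀ {b} r (f α : Fin r → ℕ) → Coprime b (prodFin r f) → Coprime b (prodFin r (λ j → f j ^ α j))
coprime-prodFin-^ zero    f α b⊥1  = b⊥1
coprime-prodFin-^ (suc r) f α b⊥Π =
  coprime-*ʳ (coprime-^ʳ (α zero) (coprime-∣ʳ b⊥Π (m∣m*n _)))
             (coprime-prodFin-^ r (f ∘ suc) (α ∘ suc) (coprime-∣ʳ b⊥Π (n∣m*n (f zero))))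

^-∣ : ∀ x {a b} → a ≤ b → x ^ a ∣ x ^ b
^-∣ x {a} {b} a≤b = divides (x ^ (b ∸ a)) (begin
  x ^ b                 ≡⟨ cong (x ^_) (m+[n∸m]≡n a≤b) ⟨
  x ^ (a + (b ∸ a))     ≡⟨ ^-distribˡ-+-* x a (b ∸ a) ⟩
  x ^ a * x ^ (b ∸ a)   ≡⟨ *-comm (x ^ a) _ ⟩
  x ^ (b ∸ a) * x ^ a   ∎)
  where open ≡-Reasoning

mutual
  subproduct-∣ : ∀ {s r} (k : Fin s → Fin r) → k Preserves _<ᶠ_ ⟶ _<ᶠ_ → (g : Fin r → ℕ) →
                 prodFin s (g ∘ k) ∣ prodFin r g
  subproduct-∣ {zero}  k k↑ g = 1∣ _
  subproduct-∣ {suc s} {zero} k k↑ g with () ← k zero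
  subproduct-∣ {suc s} {suc r} k k↑ g with k zero in k0≡
  ... | zero  = *-pres-∣ (∣-refl {g zero}) (subproduct-∣-suc (k ∘ suc) (k↑ ∘ s<s) tail-avoids-0 g)
    where
    tail-avoids-0 : ∀ i → 0 < toℕ (k (suc i))
    tail-avoids-0 i = subst (λ j → toℕ j < toℕ (k (suc i))) k0≡ (k↑ z<s)
  ... | suc _ = subst (λ x → g x * prodFin s (g ∘ k ∘ suc) ∣ prodFin (suc r) g) k0≡
                      (∣n⇒∣m*n (g zero) (subproduct-∣-suc k k↑ avoids-0 g))
    where
    avoids-0 : ∀ i → 0 < toℕ (k i)
    avoids-0 zero    rewrite k0≡ = z<s
    avoids-0 (suc i) = ≤-<-trans z≤n (k↑ {zero} {suc i} z<s)

  subproduct-∣-suc : ∀ {s r} (k : Fin s → Fin (suc r)) → k Preserves _<ᶠ_ ⟶ _<ᶠ_ → (∀ i → 0 < toℕ (k i)) →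
                     (g : Fin (suc r) → ℕ) → prodFin s (g ∘ k) ∣ prodFin r (g ∘ suc)
  subproduct-∣-suc {s} {r} k k↑ k>0 g =
    subst (_∣ prodFin r (g ∘ suc)) (prodFin-cong s (λ i → cong g (suc-unsuc (k i) (k>0 i))))
          (subproduct-∣ k′ k′↑ (g ∘ suc))
    where
    unsuc : ∀ {r} (x : Fin (suc r)) → 0 < toℕ x → Fin r
    unsuc (suc x) _ = x
    suc-unsuc : ∀ {r} (x : Fin (suc r)) (x>0 : 0 < toℕ x) → suc (unsuc x x>0) ≡ x
    suc-unsuc (suc x) _ = refl
    toℕ-unsuc : ∀ {r} (x : Fin (suc r)) (x>0 : 0 < toℕ x) → suc (toℕ (unsuc x x>0)) ≡ toℕ x
    toℕ-unsuc (suc x) _ = refl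
    k′ : Fin s → Fin r
    k′ i = unsuc (k i) (k>0 i)
    k′↑ : k′ Preserves _<ᶠ_ ⟶ _<ᶠ_
    k′↑ {i} {j} i<j = s<s⁻¹ (subst₂ _<_ (sym (toℕ-unsuc (k i) (k>0 i))) (sym (toℕ-unsuc (k j) (k>0 j))) (k↑ i<j))

∣-^ : ∀ x {a} → 1 ≤ a → x ∣ x ^ a
∣-^ x {suc a} _ = m∣m*n (x ^ a)

-- Since f j ≥ o + j, ∏ (f j + 1)/f j ≤ ∏ (o + j + 1)/(o + j) = (o + k)/o.
prodFin-telescope : ∀ k o (f : Fin k → ℕ) → (∀ j → o + toℕ j ≤ f j) →
                    o * prodFin k (λ j → suc (f j)) ≤ (o + k) * prodFin k f
prodFin-telescope zero    o f _     = ≤-reflexive (cong (_* 1) (sym (+-identityʳ o)))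
prodFin-telescope (suc k) o f f≥o+j = begin
  o * (suc f₀ * Π₊)
    ≡⟨ *-assoc o (suc f₀) Π₊ ⟨
  o * suc f₀ * Π₊
    ≤⟨ *-monoˡ-≤ Π₊ o[1+f₀]≤[1+o]f₀ ⟩
  (1 + o) * f₀ * Π₊
    ≡⟨ solve 3 (λ o f₀ Π₊ → (con 1 :+ o) :* f₀ :* Π₊ := f₀ :* ((o :+ con 1) :* Π₊)) refl o f₀ Π₊ ⟩
  f₀ * ((o + 1) * Π₊)
    ≤⟨ *-monoʳ-≤ f₀ (prodFin-telescope k (o + 1) (f ∘ suc) shifted) ⟩
  f₀ * ((o + 1 + k) * Π)
    ≡⟨ solve 4 (λ o k f₀ Π → f₀ :* ((o :+ con 1 :+ k) :* Π) := (o :+ (con 1 :+ k)) :* (f₀ :* Π))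
               refl o k f₀ Π ⟩
  (o + suc k) * (f₀ * Π) ∎
  where
  open ≤-Reasoning
  f₀ = f zero
  Π₊ = prodFin k (λ j → suc (f (suc j)))
  Π = prodFin k (f ∘ suc)
  o[1+f₀]≤[1+o]f₀ : o * suc f₀ ≤ (1 + o) * f₀
  o[1+f₀]≤[1+o]f₀ = begin
    o * suc f₀    ≡⟨ *-suc o f₀ ⟩
    o + o * f₀    ≤⟨ +-monoˡ-≤ (o * f₀) (subst (_≤ f₀) (+-identityʳ o) (f≥o+j zero)) ⟩
    f₀ + o * f₀   ∎
  shifted : ∀ j → o + 1 + toℕ j ≤ f (suc j)
  shifted j = subst (_≤ f (suc j)) (sym (+-assoc o 1 (toℕ j))) (f≥o+j (suc j))

-- Hypotheses (i) and (ii)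

TotientGrowth : ∀ r → (Fin r → ℕ) → Set
TotientGrowth r p = ∀ (j j′ : Fin r) → toℕ j′ ≡ suc (toℕ j) → r * φ (p j) ≤ φ (p j′)

totientGrowth⇒φ≥1+j : ∀ {r} {p : Fin r → ℕ} → (∀ j → Prime (p j)) → TotientGrowth r p →
                      ∀ j → 1 + toℕ j ≤ φ (p j)
totientGrowth⇒φ≥1+j prime _ zero =
  subst (1 ≤_) (sym (φ-prime (prime zero))) (∸-monoˡ-≤ 1 (prime⇒>1 (prime zero)))
totientGrowth⇒φ≥1+j {suc r} {p} prime growth (suc j) = begin
  2 + toℕ j
    ≤⟨ toℕ<n (suc j) ⟩
  suc r
    ≤⟨ m≤m*n (suc r) (φ (p (inject₁ j))) {{>-nonZero (φ-pos (<⇒≤ (prime⇒>1 (prime (inject₁ j)))))}} ⟩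
  suc r * φ (p (inject₁ j))
    ≤⟨ growth (inject₁ j) (suc j) (cong suc (sym (toℕ-inject₁ j))) ⟩
  φ (p (suc j)) ∎
  where open ≤-Reasoning

totientGrowth⇒radical-bound : ∀ r {p : Fin r → ℕ} → (∀ j → Prime (p j)) → TotientGrowth r p →
                              prodFin r p ≤ (1 + r) * φ (prodFin r p)
totientGrowth⇒radical-bound r {p} prime growth = begin
  prodFin r p                          ≡⟨ prodFin-cong r (suc-φ-prime ∘ prime) ⟨
  prodFin r (λ j → suc (φ (p j)))      ≡⟨ *-identityˡ _ ⟨
  1 * prodFin r (λ j → suc (φ (p j)))  ≤⟨ prodFin-telescope r 1 (φ ∘ p) (totientGrowth⇒φ≥1+j prime growth) ⟩
  (1 + r) * prodFin r (φ ∘ p)          ≤⟨ *-monoʳ-≤ (1 + r) (φ-prodFin r p prime) ⟩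
  (1 + r) * φ (prodFin r p)            ∎
  where open ≤-Reasoning

half-totient⇒bound : ∀ {P p t} → P ≤ 2 * φ P → p < t → 1 ≤ φ P → (p ∸ 1) * P < (t + p) * φ P
half-totient⇒bound {P} {p} {t} P≤2φP p<t φP≥1 = begin-strict
  (p ∸ 1) * P
    ≤⟨ *-monoʳ-≤ (p ∸ 1) P≤2φP ⟩
  (p ∸ 1) * (2 * φ P)
    ≡⟨ solve 2 (λ x Φ → x :* (con 2 :* Φ) := (x :+ x) :* Φ) refl (p ∸ 1) (φ P) ⟩
  ((p ∸ 1) + (p ∸ 1)) * φ P
    <⟨ *-monoˡ-< (φ P) {{>-nonZero φP≥1}} (+-mono-<-≤ (≤-<-trans (m∸n≤m p 1) p<t) (m∸n≤m p 1)) ⟩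
  (t + p) * φ P ∎
  where open ≤-Reasoning

radical-bound⇒bound : ∀ {P p t} r → P ≤ (1 + r) * φ P → r * (p ∸ 1) ≤ t ∸ 1 → 1 ≤ p → 1 ≤ φ P →
                      (p ∸ 1) * P < (t + p) * φ P
radical-bound⇒bound {P} {p} {t} r P≤[1+r]φP r[p-1]≤t-1 p≥1 φP≥1 = begin-strict
  (p ∸ 1) * P
    ≤⟨ *-monoʳ-≤ (p ∸ 1) P≤[1+r]φP ⟩
  (p ∸ 1) * ((1 + r) * φ P)
    ≡⟨ solve 3 (λ x r Φ → x :* ((con 1 :+ r) :* Φ) := (r :* x :+ x) :* Φ) refl (p ∸ 1) r (φ P) ⟩
  (r * (p ∸ 1) + (p ∸ 1)) * φ P
    <⟨ *-monoˡ-< (φ P) {{>-nonZero φP≥1}} (+-mono-≤-< (≤-trans r[p-1]≤t-1 (m∸n≤m t 1)) (∸-monoʳ-< z<s p≥1)) ⟩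
  (t + p) * φ P ∎
  where open ≤-Reasoning

module _ {r} {p : Fin r → ℕ} (prime : ∀ j → Prime (p j)) (p↑ : p Preserves _<ᶠ_ ⟶ _<_) where

  private
    φ-radical-pos : 1 ≤ φ (prodFin r p)
    φ-radical-pos = φ-pos (prodFin-pos r (λ j → <⇒≤ (prime⇒>1 (prime j))))

  growth⇒gap-bound : TotientGrowth r p → ∀ {a b} → a <ᶠ b → r * (p a ∸ 1) ≤ p b ∸ 1
  growth⇒gap-bound growth {a} {b} a<b = begin
    r * (p a ∸ 1)  ≡⟨ cong (r *_) (φ-prime (prime a)) ⟨
    r * φ (p a)    ≤⟨ growth a a+1 (toℕ-fromℕ< a+1<r) ⟩
    φ (p a+1)      ≡⟨ φ-prime (prime a+1) ⟩
    p a+1 ∸ 1      ≤⟨ ∸-monoˡ-≤ 1 p[a+1]≤p[b] ⟩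
    p b ∸ 1        ∎
    where
    open ≤-Reasoning
    a+1<r : suc (toℕ a) < r
    a+1<r = ≤-<-trans a<b (toℕ<n b)
    a+1 : Fin r
    a+1 = fromℕ< a+1<r
    p[a+1]≤p[b] : p a+1 ≤ p b
    p[a+1]≤p[b] with m≤n⇒m<n∨m≡n (subst (_≤ toℕ b) (sym (toℕ-fromℕ< a+1<r)) a<b)
    ... | inj₁ a+1<b = <⇒≤ (p↑ a+1<b)
    ... | inj₂ a+1≡b = ≤-reflexive (cong p (toℕ-injective a+1≡b))

  totient-hypothesis⇒bound : prodFin r p ≤ 2 * φ (prodFin r p) ⊎ TotientGrowth r p →
                             ∀ {a b} → a <ᶠ b → (p a ∸ 1) * prodFin r p < (p b + p a) * φ (prodFin r p)
  totient-hypothesis⇒bound (inj₁ half)   a<b = half-totient⇒bound half (p↑ a<b) φ-radical-pos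
  totient-hypothesis⇒bound (inj₂ growth) {b = b} a<b =
    radical-bound⇒bound {t = p b} r (totientGrowth⇒radical-bound r prime growth) (growth⇒gap-bound growth a<b)
                        (<⇒≤ (prime⇒>1 (prime _))) φ-radical-pos

proposition4p1 : (r : ℕ) → 2 ≤ r →
    (p : Fin r → ℕ) → (∀ j → Prime (p j)) → (∀ i j → i <ᶠ j → p i < p j) →
    (α : Fin r → ℕ) → (∀ j → 1 ≤ α j) →
    (n : ℕ) → n ≡ prodFin r (λ j → p j ^ α j) →
    (s : ℕ) → 2 ≤ s → s ≤ r →
    (k : Fin s → Fin r) → (∀ i j → i <ᶠ j → k i <ᶠ k j) →
    (β : Fin s → ℕ) → (∀ i → 1 ≤ β i × β i ≤ α (k i)) →
    (m : ℕ) → m ≡ prodFin s (λ i → p (k i) ^ β i) →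
    (prodFin r p ≤ 2 * φ (prodFin r p)
      ⊎ (∀ (j j' : Fin r) → toℕ j' ≡ suc (toℕ j) → r * φ (p j) ≤ φ (p j'))) →
    ∀ (i : Fin s) → toℕ i < s ∸ 1 →
    (q : ℕ) → q * p (k i) ≡ m → deg n q < deg n m
proposition4p1 r _ p prime p↑ α α≥1 n refl (suc s′) _ _ k k↑ β β-range m refl hypothesis i i<s′ q qpᵢ≡m =
  deg-<-of-totient-bound (p (k i)) (quotient t∣m) t (quotient P∣n) (prodFin r p) {{n≢0}}
    m∣n qpᵢ≡m (sym (equality t∣m)) pᵢ>1 pᵢ<t (<-prime⇒∤ pᵢ>1 pᵢ<t (prime (k last)))
    (equality P∣n) (coprime-prodFin-^ r p α) (totient-hypothesis⇒bound prime (p↑ _ _) hypothesis (k↑ _ _ i<last))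
  where
  open _∣_
  last = fromℕ s′
  i<last : i <ᶠ last
  i<last = subst (toℕ i <_) (sym (toℕ-fromℕ s′)) i<s′
  t = p (k last)
  pᵢ>1 : 1 < p (k i)
  pᵢ>1 = prime⇒>1 (prime (k i))
  pᵢ<t : p (k i) < t
  pᵢ<t = p↑ _ _ (k↑ _ _ i<last)
  n≢0 : NonZero n
  n≢0 = >-nonZero (prodFin-pos r (λ j → m^n>0 (p j) {{prime⇒nonZero (prime j)}} (α j)))
  m∣n : m ∣ n
  m∣n = ∣-trans (prodFin-∣ (suc s′) (λ i → ^-∣ (p (k i)) (proj₂ (β-range i))))
                (subproduct-∣ k (k↑ _ _) (λ j → p j ^ α j))
  t∣m : t ∣ m
  t∣m = ∣-trans (∣-^ t (proj₁ (β-range last))) (factor-∣-prodFin (λ i → p (k i) ^ β i) last)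
  P∣n : prodFin r p ∣ n
  P∣n = prodFin-∣ r (λ j → ∣-^ (p j) (α≥1 j))
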